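{- Let $b\ge 0$ be an integer and let $S$ be a nonempty subset of $\mathbb{Z}$. If $\mathbf{a}_1$ and $\mathbf{a}_2$ are $b$-orderings of $S$, then $$\alpha_i(S,b,\mathbf{a}_1)=\alpha_i(S,b,\mathbf{a}_2)\quad\text{for all } i=0,1,2,\dots.$$
   Context: For integers $b\ge 0$ and $a\in\mathbb{Z}$ define $\operatorname{ord}_b(a):=\sup\{k\in\mathbb{N}: a\mathbb{Z}\subseteq b^k\mathbb{Z}\}\in\mathbb{N}\cup\{+\infty\}$, with the convention $0^0=1$. For $b\ge2$ this is the largest $k$ with $b^k\mid a$ (and $\operatorname{ord}_b(0)=+\infty$); for $b=0$ it gives $\operatorname{ord}_0(0)=+\infty$ and $\operatorname{ord}_0(a)=0$ for $a\neq0$; for $b=1$ it gives $\operatorname{ord}_1(a)=+\infty$ for all $a$. An $S$-test sequence is any infinite sequence $\mathbf{a}=(a_i)_{i=0}^\infty$ of elements of $S$ (repetitions allowed). Its $b$-exponent sequence is $\alpha_i(S,b,\mathbf{a}):=\sum_{j=0}^{i-1}\operatorname{ord}_b(a_i-a_j)\in\mathbb{N}\cup\{+\infty\}$, with $\alpha_0(S,b,\mathbf{a})=0$. A $b$-ordering of $S$ is an $S$-test sequence $\mathbf{a}$ such that for every $i\ge1$, $\sum_{j=0}^{i-1}\operatorname{ord}_b(a_i-a_j)=\min_{a'\in S}\sum_{j=0}^{i-1}\operatorname{ord}_b(a'-a_j)$. -}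

module Defs where

open import Data.Nat using (ℕ; zero; suc; _≤_)
import Data.Nat as ℕ
open import Data.Integer using (ℤ; _-_; _^_; +_)
open import Data.Integer.Divisibility using (_∣_)
open import Data.Product using (_×_; Σ)
open import Relation.Binary.PropositionalEquality using (_≡_)

data ℕ∞ : Set where
  fin : ℕ → ℕ∞
  ∞   : ℕ∞

infixl 6 _+∞_
_+∞_ : ℕ∞ → ℕ∞ → ℕ∞
fin m +∞ fin n = fin (m ℕ.+ n)
fin _ +∞ ∞     = ∞
∞     +∞ _     = ∞

infix 4 _≤∞_
data _≤∞_ : ℕ∞ → ℕ∞ → Set where
  fin≤fin : ∀ {m n} → m ≤ n → fin m ≤∞ fin n
  _≤∞∞    : ∀ x → x ≤∞ ∞

-- ord_b(a) = sup { k ∈ ℕ : aℤ ⊆ b^k ℤ } = sup { k : b^k ∣ a } ∈ ℕ ∪ {+∞}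
-- (0^0 = 1 holds for Data.Integer._^_ ).  "v is that supremum":
IsOrd : ℕ → ℤ → ℕ∞ → Set
IsOrd b a v =
  ((k : ℕ) → (+ b) ^ k ∣ a → fin k ≤∞ v)
  × ((w : ℕ∞) → ((k : ℕ) → (+ b) ^ k ∣ a → fin k ≤∞ w) → v ≤∞ w)

-- A function computing ord_b (we quantify over any function with the
-- defining property; such a function is unique).
IsOrdFun : ℕ → (ℤ → ℕ∞) → Set
IsOrdFun b ord = (a : ℤ) → IsOrd b a (ord a)

partialSum : (ℤ → ℕ∞) → (ℕ → ℤ) → ℤ → ℕ → ℕ∞
partialSum ord a x zero    = fin 0
partialSum ord a x (suc i) = partialSum ord a x i +∞ ord (x - a i)

α : (ℤ → ℕ∞) → (ℕ → ℤ) → ℕ → ℕ∞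
α ord a i = partialSum ord a (a i) i

IsTestSeq : (S : ℤ → Set) → (ℕ → ℤ) → Set
IsTestSeq S a = (i : ℕ) → S (a i)

IsBOrdering : (ℤ → ℕ∞) → (S : ℤ → Set) → (ℕ → ℤ) → Set
IsBOrdering ord S a =
  IsTestSeq S a ×
  ((i : ℕ) → (a' : ℤ) → S a' → α ord a (suc i) ≤∞ partialSum ord a a' (suc i))

-- The values d(x, y) = ord_b(x − y) form an ℕ∞-valued ultrametric on ℤ. Define the
-- energy of a finite list as the sum of d over its pairs; the energy of the first n
-- terms of a b-ordering is α₀ + ⋯ + α_{n−1}. An exchange argument in the ultrametric
-- shows that any n + 1 points contain one whose distances to the remaining n points
-- sum to at least its distances to any given n points, so induction on n shows that
-- the first n terms of a b-ordering minimise the energy among all n-element lists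
-- from S. Hence two b-orderings have equal partial sums of α, and since α is
-- non-decreasing, equal partial sums force equal terms even in the presence of ∞.
module Submission where

open import Defs
open import Algebra.Bundles using (CommutativeMonoid)
open import Algebra.Structures using (IsCommutativeMonoid)
import Algebra.Properties.CommutativeSemigroup as CommutativeSemigroupProperties
open import Data.Nat using (ℕ; zero; suc; _≤_; z≤n; _∸_)
import Data.Nat as ℕ
import Data.Nat.Divisibility as ℕ
import Data.Nat.Properties as ℕ
open import Data.Integer using (ℤ; _-_; _+_; _*_; _^_; +_; ∣_∣)
import Data.Integer.Properties as ℤ
open import Data.Integer.Divisibility using (_∣_)
import Data.Integer.Divisibility.Signed as Signed
open import Data.List using (List; []; _∷_; _++_; length; map; foldr)
open import Data.List.Membership.Propositional using (_∈_)
open import Data.List.Membership.Propositional.Properties using (∈-∃++)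
open import Data.List.Relation.Unary.All as All using (All; []; _∷_)
open import Data.List.Relation.Unary.Any using (here; there)
open import Data.List.Relation.Binary.Permutation.Propositional as ↭
  using (_↭_; ↭-refl; ↭-sym; ↭-trans; ↭-prep; ↭-swap; ↭⇒↭ₛ)
open import Data.List.Relation.Binary.Permutation.Propositional.Properties
  using (∈-resp-↭; map⁺; shift; ↭-length)
import Data.List.Relation.Binary.Permutation.Setoid.Properties as SetoidPermutation
open import Data.Product using (Σ; ∃; ∃₂; _×_; _,_; proj₁; proj₂)
open import Data.Sum using (_⊎_; inj₁; inj₂)
open import Relation.Binary.Bundles using (TotalOrder)
open import Relation.Nullary using (¬_; yes; no; contradiction)
open import Relation.Nullary.Decidable using (decidable-stable)
open import Relation.Binary.PropositionalEquality
open ≡-Reasoning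

≤∞-refl : ∀ x → x ≤∞ x
≤∞-refl (fin n) = fin≤fin ℕ.≤-refl
≤∞-refl ∞       = ∞ ≤∞∞

≤∞-trans : ∀ {x y z} → x ≤∞ y → y ≤∞ z → x ≤∞ z
≤∞-trans {x} _           (_ ≤∞∞)     = x ≤∞∞
≤∞-trans (fin≤fin m≤n) (fin≤fin n≤o) = fin≤fin (ℕ.≤-trans m≤n n≤o)

≤∞-antisym : ∀ {x y} → x ≤∞ y → y ≤∞ x → x ≡ y
≤∞-antisym (fin≤fin m≤n) (fin≤fin n≤m) = cong fin (ℕ.≤-antisym m≤n n≤m)
≤∞-antisym (_ ≤∞∞)       (_ ≤∞∞)       = refl

≤∞-total : ∀ x y → x ≤∞ y ⊎ y ≤∞ x
≤∞-total (fin m) (fin n) with ℕ.≤-total m n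
... | inj₁ m≤n = inj₁ (fin≤fin m≤n)
... | inj₂ n≤m = inj₂ (fin≤fin n≤m)
≤∞-total x       ∞       = inj₁ (x ≤∞∞)
≤∞-total ∞       y       = inj₂ (y ≤∞∞)

≤∞-totalOrder : TotalOrder _ _ _
≤∞-totalOrder = record
  { isTotalOrder = record
    { isPartialOrder = record
      { isPreorder = record
        { isEquivalence = isEquivalence
        ; reflexive     = λ { refl → ≤∞-refl _ }
        ; trans         = ≤∞-trans
        }
      ; antisym = ≤∞-antisym
      }
    ; total = ≤∞-total
    }
  }

0≤∞ : ∀ x → fin 0 ≤∞ x
0≤∞ (fin n) = fin≤fin z≤n
0≤∞ ∞       = _ ≤∞∞

∞≤∞⇒≡∞ : ∀ {x} → ∞ ≤∞ x → x ≡ ∞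
∞≤∞⇒≡∞ (_ ≤∞∞) = refl

≤∞-fin-ext : ∀ x y → (∀ k → fin k ≤∞ x → fin k ≤∞ y) → x ≤∞ y
≤∞-fin-ext (fin n) y finite≤ = finite≤ n (≤∞-refl _)
≤∞-fin-ext ∞       ∞ _       = ∞ ≤∞∞
≤∞-fin-ext ∞ (fin m) finite≤ with finite≤ (suc m) (_ ≤∞∞)
... | fin≤fin 1+m≤m = contradiction 1+m≤m (ℕ.n≮n m)

+∞-assoc : ∀ x y z → (x +∞ y) +∞ z ≡ x +∞ (y +∞ z)
+∞-assoc (fin m) (fin n) (fin o) = cong fin (ℕ.+-assoc m n o)
+∞-assoc (fin m) (fin n) ∞       = refl
+∞-assoc (fin m) ∞       z       = refl
+∞-assoc ∞       y       z       = refl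

+∞-comm : ∀ x y → x +∞ y ≡ y +∞ x
+∞-comm (fin m) (fin n) = cong fin (ℕ.+-comm m n)
+∞-comm (fin m) ∞       = refl
+∞-comm ∞       (fin n) = refl
+∞-comm ∞       ∞       = refl

+∞-identityˡ : ∀ x → fin 0 +∞ x ≡ x
+∞-identityˡ (fin n) = refl
+∞-identityˡ ∞       = refl

+∞-identityʳ : ∀ x → x +∞ fin 0 ≡ x
+∞-identityʳ x = trans (+∞-comm x (fin 0)) (+∞-identityˡ x)

+∞-isCommutativeMonoid : IsCommutativeMonoid _≡_ _+∞_ (fin 0)
+∞-isCommutativeMonoid = record
  { isMonoid = record
    { isSemigroup = record
      { isMagma = record { isEquivalence = isEquivalence ; ∙-cong = cong₂ _+∞_ }
      ; assoc   = +∞-assoc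
      }
    ; identity = +∞-identityˡ , +∞-identityʳ
    }
  ; comm = +∞-comm
  }

+∞-commutativeMonoid : CommutativeMonoid _ _
+∞-commutativeMonoid = record { isCommutativeMonoid = +∞-isCommutativeMonoid }

+∞-mono-≤∞ : ∀ {x x′ y y′} → x ≤∞ x′ → y ≤∞ y′ → x +∞ y ≤∞ x′ +∞ y′
+∞-mono-≤∞ (fin≤fin m≤m′) (fin≤fin n≤n′) = fin≤fin (ℕ.+-mono-≤ m≤m′ n≤n′)
+∞-mono-≤∞ (fin≤fin _)    (_ ≤∞∞)        = _ ≤∞∞
+∞-mono-≤∞ (_ ≤∞∞)        _              = _ ≤∞∞

x≤∞y+∞x : ∀ x y → x ≤∞ y +∞ x
x≤∞y+∞x x y = subst (_≤∞ y +∞ x) (+∞-identityˡ x) (+∞-mono-≤∞ (0≤∞ y) (≤∞-refl x))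

+∞-cancelˡ-fin : ∀ m {x y} → fin m +∞ x ≡ fin m +∞ y → x ≡ y
+∞-cancelˡ-fin m {fin n} {fin o} eq = cong fin (ℕ.+-cancelˡ-≡ m n o (fin-injective eq))
  where
  fin-injective : ∀ {p q} → fin p ≡ fin q → p ≡ q
  fin-injective refl = refl
+∞-cancelˡ-fin m {∞}     {∞}     _  = refl

+∞≡∞ : ∀ x y → x +∞ y ≡ ∞ → x ≡ ∞ ⊎ y ≡ ∞
+∞≡∞ (fin m) ∞ _ = inj₂ refl
+∞≡∞ ∞       y _ = inj₁ refl

sumBelow : (ℕ → ℕ∞) → ℕ → ℕ∞
sumBelow f zero    = fin 0
sumBelow f (suc n) = sumBelow f n +∞ f n

NonDecreasing : (ℕ → ℕ∞) → Set
NonDecreasing f = ∀ n → f n ≤∞ f (suc n)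

sumBelow≡∞ : ∀ {f} → NonDecreasing f → ∀ n → sumBelow f n ≡ ∞ → f n ≡ ∞
sumBelow≡∞ {f} f↑ (suc n) Σ≡∞ with +∞≡∞ (sumBelow f n) (f n) Σ≡∞
... | inj₁ Σ′≡∞ = ∞≤∞⇒≡∞ (subst (_≤∞ f (suc n)) (sumBelow≡∞ f↑ n Σ′≡∞) (f↑ n))
... | inj₂ fn≡∞ = ∞≤∞⇒≡∞ (subst (_≤∞ f (suc n)) fn≡∞ (f↑ n))

nonDecreasing-sumBelow-injective : ∀ {f g} → NonDecreasing f → NonDecreasing g →
  (∀ n → sumBelow f n ≡ sumBelow g n) → ∀ n → f n ≡ g n
nonDecreasing-sumBelow-injective {f} {g} f↑ g↑ Σf≡Σg n with sumBelow f n in Σfₙ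
... | fin m = +∞-cancelˡ-fin m (begin
  fin m +∞ f n            ≡⟨ cong (_+∞ f n) Σfₙ ⟨
  sumBelow f (suc n)      ≡⟨ Σf≡Σg (suc n) ⟩
  sumBelow g n +∞ g n     ≡⟨ cong (_+∞ g n) (trans (sym (Σf≡Σg n)) Σfₙ) ⟩
  fin m +∞ g n            ∎)
... | ∞ = trans (sumBelow≡∞ f↑ n Σfₙ) (sym (sumBelow≡∞ g↑ n (trans (sym (Σf≡Σg n)) Σfₙ)))

∈⇒↭ : ∀ {A : Set} {x : A} {xs} → x ∈ xs → ∃ λ ys → xs ↭ x ∷ ys
∈⇒↭ {x = x} x∈xs with ys , zs , refl ← ∈-∃++ x∈xs = ys ++ zs , shift x ys zs

length-↭-∷ : ∀ {A : Set} {xs ys : List A} {x n} → xs ↭ x ∷ ys → length xs ≡ suc n → length ys ≡ n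
length-↭-∷ xs↭ |xs|≡ = ℕ.suc-injective (trans (sym (↭-length xs↭)) |xs|≡)

open import Data.List.Extrema ≤∞-totalOrder using (argmax; argmax-sel; f[⊥]≤f[argmax]; f[xs]≤f[argmax])

module _ {A : Set} (f : A → ℕ∞) where

  argmax-∈ : ∀ y ys → argmax f y ys ∈ y ∷ ys
  argmax-∈ y ys with argmax-sel f y ys
  ... | inj₁ argmax≡y  = here argmax≡y
  ... | inj₂ argmax∈ys = there argmax∈ys

  argmax-maximal : ∀ {y ys z} → z ∈ y ∷ ys → f z ≤∞ f (argmax f y ys)
  argmax-maximal {y} {ys} (here refl)  = f[⊥]≤f[argmax] {f = f} y ys
  argmax-maximal {y} {ys} (there z∈ys) = All.lookup (f[xs]≤f[argmax] y ys) z∈ys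

-- Energy in an ℕ∞-valued ultrametric space

module UltrametricEnergy {A : Set} (d : A → A → ℕ∞)
  (d-sym : ∀ x y → d x y ≡ d y x)
  (d-ultra : ∀ {u} x y z → u ≤∞ d x y → u ≤∞ d y z → u ≤∞ d x z) where

  open SetoidPermutation (setoid ℕ∞) using (foldr-commMonoid)
  open CommutativeSemigroupProperties (CommutativeMonoid.commutativeSemigroup +∞-commutativeMonoid)
    using (interchange)

  Σd : A → List A → ℕ∞
  Σd x ys = foldr _+∞_ (fin 0) (map (d x) ys)

  Σd-↭ : ∀ x {ys zs} → ys ↭ zs → Σd x ys ≡ Σd x zs
  Σd-↭ x p = foldr-commMonoid +∞-isCommutativeMonoid (↭⇒↭ₛ (map⁺ (d x) p))

  energy : List A → ℕ∞
  energy []       = fin 0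
  energy (x ∷ xs) = energy xs +∞ Σd x xs

  energy-↭ : ∀ {xs ys} → xs ↭ ys → energy xs ≡ energy ys
  energy-↭ ↭.refl        = refl
  energy-↭ (↭.prep x p)  = cong₂ _+∞_ (energy-↭ p) (Σd-↭ x p)
  energy-↭ (↭.trans p q) = trans (energy-↭ p) (energy-↭ q)
  energy-↭ {x ∷ y ∷ xs} {_ ∷ _ ∷ ys} (↭.swap _ _ p) = begin
    (energy xs +∞ Σd y xs) +∞ (d x y +∞ Σd x xs)
      ≡⟨ cong₂ _+∞_ (cong₂ _+∞_ (energy-↭ p) (Σd-↭ y p)) (cong₂ _+∞_ (d-sym x y) (Σd-↭ x p)) ⟩
    (energy ys +∞ Σd y ys) +∞ (d y x +∞ Σd x ys)
      ≡⟨ interchange (energy ys) (Σd y ys) (d y x) (Σd x ys) ⟩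
    (energy ys +∞ d y x) +∞ (Σd y ys +∞ Σd x ys)
      ≡⟨ cong ((energy ys +∞ d y x) +∞_) (+∞-comm (Σd y ys) (Σd x ys)) ⟩
    (energy ys +∞ d y x) +∞ (Σd x ys +∞ Σd y ys)
      ≡⟨ interchange (energy ys) (Σd x ys) (d y x) (Σd y ys) ⟨
    (energy ys +∞ Σd x ys) +∞ (d y x +∞ Σd y ys)
      ∎

  ≤-isosceles : ∀ {x a c} → d x a ≤∞ d c a → d x a ≤∞ d x c
  ≤-isosceles {x} {a} {c} xa≤ca = d-ultra x a c (≤∞-refl _) (subst (d x a ≤∞_) (d-sym c a) xa≤ca)

  -- Take x* ∈ X and a* ∈ Y realising max_{x ∈ X} max_{a ∈ Y} d(x, a), and recurse on
  -- X ∖ x*, Y ∖ a*. For the point x returned, d(x, a*) ≤ d(x*, a*), so by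
  -- ≤-isosceles the pair removed at this level does not spoil the comparison.
  exchange : ∀ n (X Y : List A) → length X ≡ suc n → length Y ≡ n →
    ∃₂ λ x X′ → X ↭ x ∷ X′ × Σd x Y ≤∞ Σd x X′
  exchange zero (x ∷ X′) [] _ _ = x , X′ , ↭-refl , 0≤∞ _
  exchange (suc n) (x₀ ∷ X₀) (y ∷ Y₀) |X|≡ |Y|≡ = split
    where
    farthest : A → A
    farthest x = argmax (d x) y Y₀
    reach : A → ℕ∞
    reach x = d x (farthest x)
    x* : A
    x* = argmax reach x₀ X₀
    a* : A
    a* = farthest x*
    d[x,a*]≤d[x,x*] : ∀ {x} → x ∈ x₀ ∷ X₀ → d x a* ≤∞ d x x*
    d[x,a*]≤d[x,x*] x∈X = ≤-isosceles
      (≤∞-trans (argmax-maximal (d _) (argmax-∈ (d x*) y Y₀)) (argmax-maximal reach x∈X))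

    split : ∃₂ λ x X′ → x₀ ∷ X₀ ↭ x ∷ X′ × Σd x (y ∷ Y₀) ≤∞ Σd x X′
    split
      with X₁ , X↭x*X₁ ← ∈⇒↭ (argmax-∈ reach x₀ X₀)
      with Y₁ , Y↭a*Y₁ ← ∈⇒↭ (argmax-∈ (d x*) y Y₀)
      with x , X₂ , X₁↭xX₂ , Σd≤ ← exchange n X₁ Y₁ (length-↭-∷ X↭x*X₁ |X|≡) (length-↭-∷ Y↭a*Y₁ |Y|≡)
      = let X↭ = ↭-trans X↭x*X₁ (↭-trans (↭-prep x* X₁↭xX₂) (↭-swap x* x ↭-refl)) in
        x , x* ∷ X₂ , X↭ ,
        subst (_≤∞ Σd x (x* ∷ X₂)) (sym (Σd-↭ x Y↭a*Y₁))
          (+∞-mono-≤∞ (d[x,a*]≤d[x,x*] (∈-resp-↭ (↭-sym X↭) (here refl))) Σd≤)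

  prefix : (ℕ → A) → ℕ → List A
  prefix s zero    = []
  prefix s (suc n) = s n ∷ prefix s n

  length-prefix : ∀ s n → length (prefix s n) ≡ n
  length-prefix s zero    = refl
  length-prefix s (suc n) = cong suc (length-prefix s n)

  gap : (ℕ → A) → ℕ → ℕ∞
  gap s n = Σd (s n) (prefix s n)

  IsGreedy : (A → Set) → (ℕ → A) → Set
  IsGreedy S s = (∀ n → S (s n)) × (∀ n x → S x → gap s n ≤∞ Σd x (prefix s n))

  energy-prefix : ∀ s n → energy (prefix s n) ≡ sumBelow (gap s) n
  energy-prefix s zero    = refl
  energy-prefix s (suc n) = cong (_+∞ gap s n) (energy-prefix s n)

  gap-nonDecreasing : ∀ {S s} → IsGreedy S s → NonDecreasing (gap s)
  gap-nonDecreasing {s = s} (s∈S , greedy) n =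
    ≤∞-trans (greedy n (s (suc n)) (s∈S (suc n))) (x≤∞y+∞x _ (d (s (suc n)) (s n)))

  greedy-prefix-⊆ : ∀ {S s} → IsGreedy S s → ∀ n → All S (prefix s n)
  greedy-prefix-⊆ _                  zero    = []
  greedy-prefix-⊆ greedy@(s∈S , _) (suc n) = s∈S n ∷ greedy-prefix-⊆ greedy n

  greedy-minimises-energy : ∀ {S s} → IsGreedy S s →
    ∀ n X → length X ≡ n → All S X → energy (prefix s n) ≤∞ energy X
  greedy-minimises-energy _ zero [] _ _ = ≤∞-refl _
  greedy-minimises-energy {S} {s} greedy@(_ , minimal) (suc n) X |X|≡ X⊆S
    with x , X′ , X↭ , Σd≤ ← exchange n X (prefix s n) |X|≡ (length-prefix s n)
    with x∈S ∷ X′⊆S ← All.tabulate {P = S} (λ z∈ → All.lookup X⊆S (∈-resp-↭ (↭-sym X↭) z∈))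
    = subst (energy (prefix s (suc n)) ≤∞_) (sym (energy-↭ X↭))
        (+∞-mono-≤∞ (greedy-minimises-energy greedy n X′ (length-↭-∷ X↭ |X|≡) X′⊆S)
                    (≤∞-trans (minimal n x x∈S) Σd≤))

  greedy-gaps-unique : ∀ {S s t} → IsGreedy S s → IsGreedy S t → ∀ n → gap s n ≡ gap t n
  greedy-gaps-unique {S} {s} {t} s-greedy t-greedy =
    nonDecreasing-sumBelow-injective (gap-nonDecreasing s-greedy) (gap-nonDecreasing t-greedy)
      λ n → begin
        sumBelow (gap s) n    ≡⟨ energy-prefix s n ⟨
        energy (prefix s n)   ≡⟨ ≤∞-antisym (minimal s-greedy t-greedy n) (minimal t-greedy s-greedy n) ⟩
        energy (prefix t n)   ≡⟨ energy-prefix t n ⟩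
        sumBelow (gap t) n    ∎
    where
    minimal : ∀ {r r′} → IsGreedy S r → IsGreedy S r′ → ∀ n → energy (prefix r n) ≤∞ energy (prefix r′ n)
    minimal {r′ = r′} r-greedy r′-greedy n =
      greedy-minimises-energy r-greedy n (prefix r′ n) (length-prefix r′ n) (greedy-prefix-⊆ r′-greedy n)

-- The b-adic valuation

module _ {b : ℕ} where

  ^-mono-∣ : ∀ {k j} → k ≤ j → (+ b) ^ k ∣ (+ b) ^ j
  ^-mono-∣ {k} {j} k≤j = Signed.∣⇒∣ᵤ (subst (Signed._∣_ ((+ b) ^ k)) (begin
    (+ b) ^ k * (+ b) ^ (j ∸ k) ≡⟨ ℤ.^-distribˡ-+-* (+ b) k (j ∸ k) ⟨
    (+ b) ^ (k ℕ.+ (j ∸ k))     ≡⟨ cong ((+ b) ^_) (ℕ.m+[n∸m]≡n k≤j) ⟩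
    (+ b) ^ j                   ∎) (Signed.∣m⇒∣m*n _ Signed.∣-refl))

  IsOrd⇒∣ : ∀ {a v k} → IsOrd b a v → fin k ≤∞ v → (+ b) ^ k ∣ a
  IsOrd⇒∣ {k = zero}  _               _     = ℕ.1∣ _
  IsOrd⇒∣ {a} {k = suc k} (_ , least) k<v = decidable-stable (_ ℕ.∣? _) λ bᵏ⁺¹∤a →
    contradiction (≤∞-trans k<v (least (fin k) (below bᵏ⁺¹∤a))) λ { (fin≤fin k<k) → ℕ.n≮n k k<k }
    where
    below : ¬ ((+ b) ^ suc k ∣ a) → ∀ j → (+ b) ^ j ∣ a → fin j ≤∞ fin k
    below bᵏ⁺¹∤a j bʲ∣a with j ℕ.≤? k
    ... | yes j≤k = fin≤fin j≤k
    ... | no j≰k  = contradiction (ℕ.∣-trans (^-mono-∣ (ℕ.≰⇒> j≰k)) bʲ∣a) bᵏ⁺¹∤a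

module _ {b : ℕ} {ord : ℤ → ℕ∞} (ordᵇ : IsOrdFun b ord) where

  ord-mono-∣ : ∀ {a c} → (∀ k → (+ b) ^ k ∣ a → (+ b) ^ k ∣ c) → ord a ≤∞ ord c
  ord-mono-∣ {a} {c} a∣⇒c∣ = proj₂ (ordᵇ a) (ord c) λ k bᵏ∣a → proj₁ (ordᵇ c) k (a∣⇒c∣ k bᵏ∣a)

  ord-cong-∣∣ : ∀ {a c} → ∣ a ∣ ≡ ∣ c ∣ → ord a ≡ ord c
  ord-cong-∣∣ ∣a∣≡∣c∣ = ≤∞-antisym
    (ord-mono-∣ λ k → subst (ℕ._∣_ _) ∣a∣≡∣c∣)
    (ord-mono-∣ λ k → subst (ℕ._∣_ _) (sym ∣a∣≡∣c∣))

  ord-+ : ∀ {u} a c → u ≤∞ ord a → u ≤∞ ord c → u ≤∞ ord (a + c)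
  ord-+ {u} a c u≤a u≤c = ≤∞-fin-ext u (ord (a + c)) λ k k≤u →
    proj₁ (ordᵇ (a + c)) k (Signed.∣⇒∣ᵤ (Signed.∣m∣n⇒∣m+n {(+ b) ^ k} {a} {c}
      (Signed.∣ᵤ⇒∣ (IsOrd⇒∣ {a = a} (ordᵇ a) (≤∞-trans k≤u u≤a)))
      (Signed.∣ᵤ⇒∣ (IsOrd⇒∣ {a = c} (ordᵇ c) (≤∞-trans k≤u u≤c)))))

  ord-dist-sym : ∀ x y → ord (x - y) ≡ ord (y - x)
  ord-dist-sym x y = ord-cong-∣∣ (ℤ.∣i-j∣≡∣j-i∣ x y)

  ord-dist-ultra : ∀ {u} x y z → u ≤∞ ord (x - y) → u ≤∞ ord (y - z) → u ≤∞ ord (x - z)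
  ord-dist-ultra x y z u≤xy u≤yz =
    subst (λ w → _ ≤∞ ord w) (ℤ.+-minus-telescope x y z) (ord-+ (x - y) (y - z) u≤xy u≤yz)

  open UltrametricEnergy (λ x y → ord (x - y)) ord-dist-sym ord-dist-ultra

  partialSum≡Σd : ∀ s x n → partialSum ord s x n ≡ Σd x (prefix s n)
  partialSum≡Σd s x zero    = refl
  partialSum≡Σd s x (suc n) = trans (cong (_+∞ ord (x - s n)) (partialSum≡Σd s x n)) (+∞-comm _ _)

  α≡gap : ∀ s n → α ord s n ≡ gap s n
  α≡gap s n = partialSum≡Σd s (s n) n

  bOrdering⇒greedy : ∀ {S s} → IsBOrdering ord S s → IsGreedy S s
  bOrdering⇒greedy {S} {s} (s∈S , minimal) = s∈S , greedy
    where
    greedy : ∀ n x → S x → gap s n ≤∞ Σd x (prefix s n)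
    greedy zero    x x∈S = ≤∞-refl _
    greedy (suc n) x x∈S =
      subst₂ _≤∞_ (partialSum≡Σd s (s (suc n)) (suc n)) (partialSum≡Σd s x (suc n)) (minimal n x x∈S)

theorem3p3 : (b : ℕ) (ord : ℤ → ℕ∞) → IsOrdFun b ord →
    (S : ℤ → Set) → Σ ℤ S →
    (a₁ a₂ : ℕ → ℤ) → IsBOrdering ord S a₁ → IsBOrdering ord S a₂ →
    (i : ℕ) → α ord a₁ i ≡ α ord a₂ i
theorem3p3 b ord ordᵇ S _ a₁ a₂ a₁-ordering a₂-ordering i = begin
  α ord a₁ i  ≡⟨ α≡gap ordᵇ a₁ i ⟩
  gap a₁ i    ≡⟨ greedy-gaps-unique (bOrdering⇒greedy ordᵇ a₁-ordering) (bOrdering⇒greedy ordᵇ a₂-ordering) i ⟩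
  gap a₂ i    ≡⟨ α≡gap ordᵇ a₂ i ⟨
  α ord a₂ i  ∎
  where open UltrametricEnergy (λ x y → ord (x - y)) (ord-dist-sym ordᵇ) (ord-dist-ultra ordᵇ)
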